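{- Let $\mathbf{z}$ be an infinite word over a finite alphabet such that for some integer $k\ge 2$ we have $b^{(k)}_{\mathbf{z}}(n)=n+1$ for all $n\ge 0$. Then $\mathbf{z}$ is Sturmian.
   Context: For words $u,w$, $\binom{u}{w}$ denotes the number of occurrences of $w$ as a scattered subword of $u$. Two words $u,v$ are $k$-binomially equivalent ($u\sim_k v$) if $\binom{u}{x}=\binom{v}{x}$ for all words $x$ of length at most $k$. For an infinite word $\mathbf{x}$, $b^{(k)}_{\mathbf{x}}(n)$ is the number of $\sim_k$-equivalence classes among the length-$n$ factors of $\mathbf{x}$. An infinite word is Sturmian if it has exactly $n+1$ distinct factors of length $n$ for every $n\ge0$. -}

module Defs where

open import Data.Nat using (ℕ; zero; suc; _+_; _≤_)
open import Data.Fin using (Fin; toℕ; _≟_)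
open import Data.List using (List; []; _∷_; length)
open import Data.Vec using (Vec; tabulate; toList)
open import Data.Product using (Σ; ∃; _×_)
open import Relation.Nullary using (¬_; yes; no)
open import Relation.Binary.PropositionalEquality using (_≡_; _≢_)

Word : ℕ → Set
Word m = ℕ → Fin m

factor : ∀ {m} → Word m → ℕ → (n : ℕ) → Vec (Fin m) n
factor z i n = tabulate (λ j → z (i + toℕ j))

binom : ∀ {m} → List (Fin m) → List (Fin m) → ℕ
binom u [] = 1
binom [] (_ ∷ _) = 0
binom (a ∷ u) (b ∷ w) with a ≟ b
... | yes _ = binom u (b ∷ w) + binom u w
... | no _  = binom u (b ∷ w)

_∼[_]_ : ∀ {m} → List (Fin m) → ℕ → List (Fin m) → Set
u ∼[ k ] v = ∀ x → length x ≤ k → binom u x ≡ binom v x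

-- "The length-n factors of z fall into exactly c classes of the relation R":
-- there are c starting positions whose factors are pairwise R-inequivalent,
-- and every length-n factor is R-related to one of them.
ClassCount : ∀ {m} → Word m → (n : ℕ) →
             (Vec (Fin m) n → Vec (Fin m) n → Set) → ℕ → Set
ClassCount z n R c =
  Σ (Fin c → ℕ) λ rep →
    (∀ i j → i ≢ j → ¬ R (factor z (rep i) n) (factor z (rep j) n)) ×
    (∀ p → ∃ λ j → R (factor z p n) (factor z (rep j) n))

binomialComplexityIs : ∀ {m} → ℕ → Word m → ℕ → ℕ → Set
binomialComplexityIs k z n c =
  ClassCount z n (λ u v → toList u ∼[ k ] toList v) c

factorComplexityIs : ∀ {m} → Word m → ℕ → ℕ → Set
factorComplexityIs z n c = ClassCount z n _≡_ c

Sturmian : ∀ {m} → Word m → Set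
Sturmian z = ∀ n → factorComplexityIs z n (suc n)

{-# OPTIONS --safe #-}
-- The factors of length 1 show that z is a word over two letters α and β. On binary words,
-- 2-binomial equivalence sees the number of α's and the weight (the number of pairs of
-- positions i < j with an α at i); when all shorter factors are balanced these two numbers
-- determine the factor, so below the first unbalanced length z has exactly n + 1 factors of
-- each length n. Balance is then proved by strong induction: a shortest unbalanced pair of
-- factors has the form αwα, βwβ with w a palindrome, and w is the unique right special factor
-- of its length. As z has n + 1 distinct factors of every length it is not eventually periodic,
-- which forces both αw and βw to be right special, contradicting uniqueness one length up.
module Submission where

open import Defs
open import Data.Nat using (ℕ; zero; suc; _+_; _*_; _∸_; _≤_; _<_; z≤n; s≤s; _≤?_; _<?_; s≤s⁻¹)
open import Data.Nat.Properties
open import Data.Nat.Induction using (<-rec)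
open import Data.Nat.DivMod using (_%_; _/_; m%n<n; m≡m%n+[m/n]*n)
open import Data.Nat.Solver using (module +-*-Solver)
open import Data.Fin using (Fin; toℕ; fromℕ<) renaming (zero to fz; suc to fs; _≟_ to _≟F_)
open import Data.Fin.Properties using (toℕ<n; toℕ-fromℕ<; fromℕ<-injective; pigeonhole)
open import Data.List using (List; []; _∷_; length)
open import Data.Vec using (Vec; tabulate; toList; lookup)
open import Data.Vec.Properties using (tabulate-cong; lookup∘tabulate; ≡-dec)
open import Data.Product using (Σ; ∃; ∃₂; _×_; _,_; proj₁; proj₂)
open import Data.Sum using (_⊎_; inj₁; inj₂)
open import Data.Empty using (⊥; ⊥-elim)
open import Relation.Nullary using (¬_; yes; no; Dec)
open import Relation.Binary.PropositionalEquality

open +-*-Solver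

least-below : {P : ℕ → Set} → (∀ c → Dec (P c)) → ∀ N →
              (∀ c → c < N → ¬ P c) ⊎ (∃ λ c → c < N × P c × (∀ c′ → c′ < c → ¬ P c′))
least-below P? zero = inj₁ (λ _ ())
least-below P? (suc N) with least-below P? N
... | inj₂ (c , c<N , Pc , below) = inj₂ (c , m<n⇒m<1+n c<N , Pc , below)
... | inj₁ none with P? N
...   | yes PN = inj₂ (N , ≤-refl , PN , none)
...   | no ¬PN = inj₁ none′
  where
    none′ : ∀ c → c < suc N → ¬ _
    none′ c c<1+N with c <? N
    ... | yes c<N = none c c<N
    ... | no c≮N rewrite ≤-antisym (s≤s⁻¹ c<1+N) (≮⇒≥ c≮N) = ¬PN

module Factors {m : ℕ} (z : Word m) where

  SameLetter : ℕ → ℕ → Set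
  SameLetter p q = z p ≡ z q

  Agree : ℕ → ℕ → ℕ → Set
  Agree n p q = ∀ r → r < n → SameLetter (p + r) (q + r)

  agree-refl : ∀ {n p} → Agree n p p
  agree-refl r _ = refl

  agree-sym : ∀ {n p q} → Agree n p q → Agree n q p
  agree-sym w r r<n = sym (w r r<n)

  agree-trans : ∀ {n p q s} → Agree n p q → Agree n q s → Agree n p s
  agree-trans w w′ r r<n = trans (w r r<n) (w′ r r<n)

  agree-≤ : ∀ {n n′ p q} → n′ ≤ n → Agree n p q → Agree n′ p q
  agree-≤ n′≤n w r r<n′ = w r (<-≤-trans r<n′ n′≤n)

  agree-init : ∀ {n p q} → Agree (suc n) p q → Agree n p q
  agree-init = agree-≤ (n≤1+n _)

  agree-last : ∀ {n p q} → Agree (suc n) p q → SameLetter (p + n) (q + n)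
  agree-last w = w _ ≤-refl

  agree-head : ∀ {n p q} → Agree (suc n) p q → SameLetter p q
  agree-head {p = p} {q} w = subst₂ SameLetter (+-identityʳ p) (+-identityʳ q) (w 0 (s≤s z≤n))

  agree-tail : ∀ {n p q} → Agree (suc n) p q → Agree n (suc p) (suc q)
  agree-tail {p = p} {q} w r r<n = subst₂ SameLetter (+-suc p r) (+-suc q r) (w (suc r) (s≤s r<n))

  agree-cons : ∀ {n p q} → SameLetter p q → Agree n (suc p) (suc q) → Agree (suc n) p q
  agree-cons {p = p} {q} e w zero _ = subst₂ SameLetter (sym (+-identityʳ p)) (sym (+-identityʳ q)) e
  agree-cons {p = p} {q} e w (suc r) (s≤s r<n) = subst₂ SameLetter (sym (+-suc p r)) (sym (+-suc q r)) (w r r<n)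

  agree-snoc : ∀ {n p q} → Agree n p q → SameLetter (p + n) (q + n) → Agree (suc n) p q
  agree-snoc {n} {p} {q} w e r r<1+n with r <? n
  ... | yes r<n = w r r<n
  ... | no r≮n = subst (λ t → SameLetter (p + t) (q + t)) (sym (≤-antisym (s≤s⁻¹ r<1+n) (≮⇒≥ r≮n))) e

  agree-shift : ∀ {n p q} → Agree n p q → SameLetter (p + n) (q + n) → Agree n (suc p) (suc q)
  agree-shift w e = agree-tail (agree-snoc w e)

  agree-slice : ∀ {n p q} d {s} → d + s ≤ n → Agree n p q → Agree s (p + d) (q + d)
  agree-slice {p = p} {q} d d+s≤n w r r<s = subst₂ SameLetter (sym (+-assoc p d r)) (sym (+-assoc q d r))
    (w (d + r) (<-≤-trans (+-monoʳ-< d r<s) d+s≤n))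

  factor≡⇒agree : ∀ {n p q} → factor z p n ≡ factor z q n → Agree n p q
  factor≡⇒agree {n} {p} {q} e r r<n = begin
      z (p + r)                ≡⟨ cong (λ t → z (p + t)) (sym (toℕ-fromℕ< r<n)) ⟩
      z (p + toℕ i)            ≡⟨ sym (lookup∘tabulate (λ j → z (p + toℕ j)) i) ⟩
      lookup (factor z p n) i  ≡⟨ cong (λ v → lookup v i) e ⟩
      lookup (factor z q n) i  ≡⟨ lookup∘tabulate (λ j → z (q + toℕ j)) i ⟩
      z (q + toℕ i)            ≡⟨ cong (λ t → z (q + t)) (toℕ-fromℕ< r<n) ⟩
      z (q + r)                ∎
    where
      open ≡-Reasoning
      i = fromℕ< r<n

  agree⇒factor≡ : ∀ {n p q} → Agree n p q → factor z p n ≡ factor z q n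
  agree⇒factor≡ w = tabulate-cong (λ j → w (toℕ j) (toℕ<n j))

  agree? : ∀ n p q → Dec (Agree n p q)
  agree? n p q with ≡-dec _≟F_ (factor z p n) (factor z q n)
  ... | yes e = yes (factor≡⇒agree e)
  ... | no ne = no (λ w → ne (agree⇒factor≡ w))

  letters : ℕ → ℕ → List (Fin m)
  letters p zero = []
  letters p (suc n) = z p ∷ letters (suc p) n

  toList-factor : ∀ p n → toList (factor z p n) ≡ letters p n
  toList-factor p zero = refl
  toList-factor p (suc n) = cong₂ _∷_ (cong z (+-identityʳ p))
    (trans (cong toList (tabulate-cong (λ j → cong z (+-suc p (toℕ j))))) (toList-factor (suc p) n))

  RightDeterministic : ℕ → ℕ → Set
  RightDeterministic n q = ∀ p → Agree n p q → SameLetter (p + n) (q + n)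

  RightSpecial : ℕ → ℕ → ℕ → Set
  RightSpecial n p q = Agree n p q × ¬ SameLetter (p + n) (q + n)

  PeriodicFrom : ℕ → ℕ → Set
  PeriodicFrom t P = ∀ x → z (t + x) ≡ z (t + suc P + x)

  EventuallyPeriodic : Set
  EventuallyPeriodic = ∃₂ PeriodicFrom

  ManyFactors : ℕ → ℕ → Set
  ManyFactors n c = Σ (Fin c → ℕ) λ pos → ∀ i j → Agree n (pos i) (pos j) → i ≡ j

  FewFactors : ℕ → ℕ → Set
  FewFactors n c = Σ (ℕ → Fin c) λ class → ∀ p q → class p ≡ class q → Agree n p q

  classCount⇒manyFactors : ∀ {n c R} → (∀ {u v} → u ≡ v → R u v) → ClassCount z n R c → ManyFactors n c
  classCount⇒manyFactors R-reflexive (rep , separated , _) = rep , injective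
    where
      injective : ∀ i j → Agree _ (rep i) (rep j) → i ≡ j
      injective i j w with i ≟F j
      ... | yes i≡j = i≡j
      ... | no i≢j = ⊥-elim (separated i j i≢j (R-reflexive (agree⇒factor≡ w)))

  classCount-≡ : ∀ {n c R} → (∀ {u v} → u ≡ v → R u v) → (∀ p q → R (factor z p n) (factor z q n) → factor z p n ≡ factor z q n) →
                 ClassCount z n R c → factorComplexityIs z n c
  classCount-≡ R-reflexive R⇒≡ (rep , separated , covered) =
    rep , (λ i j i≢j e → separated i j i≢j (R-reflexive e)) , λ p → proj₁ (covered p) , R⇒≡ p _ (proj₂ (covered p))

  fewFactors-collision : ∀ {n c} → FewFactors n c → (pos : Fin (suc c) → ℕ) →
                         ∃₂ λ i j → toℕ i < toℕ j × Agree n (pos i) (pos j)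
  fewFactors-collision (class , agree-of-class) pos with pigeonhole ≤-refl (λ i → class (pos i))
  ... | i , j , i<j , same = i , j , i<j , agree-of-class (pos i) (pos j) same

  ¬many×few : ∀ {n c} → ManyFactors n (suc c) → FewFactors n c → ⊥
  ¬many×few (pos , pos-injective) few with fewFactors-collision few pos
  ... | i , j , i<j , w = <-irrefl (cong toℕ (pos-injective i j w)) i<j

  module _ {t P : ℕ} (periodic : PeriodicFrom t P) where

    periodic-iterate : ∀ q x → z (t + x) ≡ z (t + q * suc P + x)
    periodic-iterate zero x = cong (λ u → z (u + x)) (sym (+-identityʳ t))
    periodic-iterate (suc q) x = begin
        z (t + x)                       ≡⟨ periodic-iterate q x ⟩
        z (t + q * suc P + x)           ≡⟨ cong z (+-assoc t _ x) ⟩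
        z (t + (q * suc P + x))         ≡⟨ periodic (q * suc P + x) ⟩
        z (t + suc P + (q * suc P + x)) ≡⟨ cong z (solve 4 (λ t p qp x → t :+ p :+ (qp :+ x) := t :+ (p :+ qp) :+ x)
                                                     refl t (suc P) (q * suc P) x) ⟩
        z (t + suc q * suc P + x)       ∎
      where open ≡-Reasoning

    periodic-reduce : ∀ p → Σ ℕ λ p′ → p′ < t + suc P × Agree (t + suc P) p p′
    periodic-reduce p with p <? t
    ... | yes p<t = p , <-≤-trans p<t (m≤m+n t (suc P)) , agree-refl
    ... | no p≮t = t + d % suc P , +-monoʳ-< t (m%n<n d (suc P)) , agree
      where
        d = p ∸ t
        p≡ : p ≡ t + (d % suc P + d / suc P * suc P)
        p≡ = trans (sym (m+[n∸m]≡n (≮⇒≥ p≮t))) (cong (t +_) (m≡m%n+[m/n]*n d (suc P)))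
        agree : Agree (t + suc P) p (t + d % suc P)
        agree r _ = begin
            z (p + r)                                   ≡⟨ cong (λ u → z (u + r)) p≡ ⟩
            z (t + (d % suc P + d / suc P * suc P) + r) ≡⟨ cong z (solve 4 (λ t a b r → t :+ (a :+ b) :+ r := t :+ b :+ (a :+ r))
                                                                 refl t (d % suc P) (d / suc P * suc P) r) ⟩
            z (t + d / suc P * suc P + (d % suc P + r)) ≡⟨ sym (periodic-iterate (d / suc P) _) ⟩
            z (t + (d % suc P + r))                     ≡⟨ cong z (sym (+-assoc t _ r)) ⟩
            z (t + d % suc P + r)                       ∎
          where open ≡-Reasoning

    periodic⇒fewFactors : FewFactors (t + suc P) (t + suc P)
    periodic⇒fewFactors = class , agree-of-class
      where
        class : ℕ → Fin (t + suc P)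
        class p = fromℕ< (proj₁ (proj₂ (periodic-reduce p)))
        agree-of-class : ∀ p q → class p ≡ class q → Agree (t + suc P) p q
        agree-of-class p q same with periodic-reduce p | periodic-reduce q | fromℕ<-injective _ _ _ _ same
        ... | p′ , _ , wp | .p′ , _ , wq | refl = agree-trans wp (agree-sym wq)

  aperiodic : (∀ n → ManyFactors n (suc n)) → ¬ EventuallyPeriodic
  aperiodic many (t , P , periodic) = ¬many×few (many (t + suc P)) (periodic⇒fewFactors periodic)

  module Classes {n c : ℕ} (C : factorComplexityIs z n c) where

    rep : Fin c → ℕ
    rep = proj₁ C

    class : ℕ → Fin c
    class p = proj₁ (proj₂ (proj₂ C) p)

    agree-rep : ∀ p → Agree n p (rep (class p))
    agree-rep p = factor≡⇒agree (proj₂ (proj₂ (proj₂ C) p))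

    rep-injective : ∀ i j → Agree n (rep i) (rep j) → i ≡ j
    rep-injective = proj₂ (classCount⇒manyFactors (λ e → e) C)

    few : FewFactors n c
    few = class , λ p q same →
      agree-trans (agree-rep p) (subst (λ i → Agree n (rep i) q) (sym same) (agree-sym (agree-rep q)))

    Escape : ℕ → Set
    Escape u = Σ ℕ λ e → Agree n e u × ¬ SameLetter (e + n) (rep (class u) + n)

    escape : ∀ {u u′} → RightSpecial n u u′ → Escape u
    escape {u} {u′} (w , ne) with z (u + n) ≟F z (rep (class u) + n)
    ... | no u-escapes = u , agree-refl , u-escapes
    ... | yes same = u′ , agree-sym w , λ e → ne (trans same (sym e))

    escape-not-rep : ∀ {u} ((e , _) : Escape u) r → ¬ Agree (suc n) e (rep r)
    escape-not-rep {u} (e , we , ne) r w = ne (subst (λ i → SameLetter (e + n) (rep i + n)) (sym class-u≡r) (agree-last w))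
      where
        class-u≡r : class u ≡ r
        class-u≡r = rep-injective (class u) r
          (agree-trans (agree-sym (agree-rep u)) (agree-trans (agree-sym we) (agree-init w)))

  rightSpecial-unique : ∀ {n p p′ q q′} →
    factorComplexityIs z n (suc n) → factorComplexityIs z (suc n) (suc (suc n)) →
    RightSpecial n p p′ → RightSpecial n q q′ → Agree n p q
  rightSpecial-unique {n} {p} {p′} {q} {q′} Cn Cn+1 sp sq = resolve (fewFactors-collision (Classes.few Cn+1) pos)
    where
      open Classes Cn
      eP = escape sp
      eQ = escape sq

      pos : Fin (suc (suc (suc n))) → ℕ
      pos fz = proj₁ eP
      pos (fs fz) = proj₁ eQ
      pos (fs (fs r)) = rep r

      resolve : (∃₂ λ i j → toℕ i < toℕ j × Agree (suc n) (pos i) (pos j)) → Agree n p q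
      resolve (fz , fs fz , _ , w) = agree-trans (agree-sym (proj₁ (proj₂ eP))) (agree-trans (agree-init w) (proj₁ (proj₂ eQ)))
      resolve (fz , fs (fs r) , _ , w) = ⊥-elim (escape-not-rep eP r w)
      resolve (fs fz , fs (fs r) , _ , w) = ⊥-elim (escape-not-rep eQ r w)
      resolve (fs (fs r) , fs (fs r′) , s≤s (s≤s r<r′) , w) = ⊥-elim (<-irrefl (cong toℕ (rep-injective r r′ (agree-init w))) r<r′)
      resolve (fz , fz , () , _)
      resolve (fs fz , fz , () , _)
      resolve (fs fz , fs fz , s≤s () , _)
      resolve (fs (fs _) , fz , () , _)
      resolve (fs (fs _) , fs fz , s≤s () , _)

  deterministic-tail : ∀ {n q} → RightDeterministic n (suc q) → RightDeterministic (suc n) q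
  deterministic-tail {n} {q} det p w = subst₂ SameLetter (sym (+-suc p n)) (sym (+-suc q n)) (det (suc p) (agree-tail w))

  ¬deterministic⇒¬¬rightSpecial : ∀ {n q} → ¬ RightDeterministic n q → ¬ ¬ (∃ λ p → RightSpecial n q p)
  ¬deterministic⇒¬¬rightSpecial {n} {q} ¬det none = ¬det deterministic
    where
      deterministic : RightDeterministic n q
      deterministic p w with z (p + n) ≟F z (q + n)
      ... | yes same = same
      ... | no differ = ⊥-elim (none (p , agree-sym w , λ e → differ (sym e)))

  deterministic-run⇒periodic : ∀ {L s P} → Agree L s (s + suc P) →
    (∀ r → r < suc P → RightDeterministic L (s + r)) → EventuallyPeriodic
  deterministic-run⇒periodic {L} {s} {P} w₀ run = s + L , P , periodic
    where
      Step : ℕ → Set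
      Step r = Agree L (s + r) (s + suc P + r) × RightDeterministic L (s + r)

      step : ∀ r → Step r
      step = <-rec Step go
        where
          go : ∀ r → (∀ {r′} → r′ < r → Step r′) → Step r
          go zero _ = subst₂ (Agree L) (sym (+-identityʳ s)) (sym (+-identityʳ _)) w₀ , run 0 (s≤s z≤n)
          go (suc r) earlier = agree-next , deterministic-next
            where
              previous = earlier ≤-refl

              agree-next : Agree L (s + suc r) (s + suc P + suc r)
              agree-next = subst₂ (Agree L) (sym (+-suc s r)) (sym (+-suc _ r))
                (agree-shift (proj₁ previous) (sym (proj₂ previous _ (agree-sym (proj₁ previous)))))

              -- beyond the given run, the window at s + r recurs at s + r − (P + 1)
              deterministic-next : RightDeterministic L (s + suc r)
              deterministic-next with suc r <? suc P
              ... | yes r<P = run (suc r) r<P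
              ... | no r≮P = λ p w → trans (proj₂ back p (agree-trans w recur)) (sym (proj₂ back (s + suc r) recur))
                where
                  e = proj₁ (m≤n⇒∃[o]m+o≡n (≮⇒≥ r≮P))
                  P+e≡r : suc P + e ≡ suc r
                  P+e≡r = proj₂ (m≤n⇒∃[o]m+o≡n (≮⇒≥ r≮P))
                  back = earlier (s≤s (subst (e ≤_) (suc-injective P+e≡r) (m≤n+m e P)))
                  recur : Agree L (s + suc r) (s + e)
                  recur = subst (λ t → Agree L t (s + e)) (trans (+-assoc s (suc P) e) (cong (s +_) P+e≡r)) (agree-sym (proj₁ back))

      periodic : PeriodicFrom (s + L) P
      periodic x = begin
          z (s + L + x)         ≡⟨ cong z (solve 3 (λ s L x → s :+ L :+ x := s :+ x :+ L) refl s L x) ⟩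
          z (s + x + L)         ≡⟨ sym (proj₂ (step x) (s + suc P + x) (agree-sym (proj₁ (step x)))) ⟩
          z (s + suc P + x + L) ≡⟨ cong z (solve 4 (λ s L P x → s :+ P :+ x :+ L := s :+ L :+ P :+ x) refl s L (suc P) x) ⟩
          z (s + L + suc P + x) ∎
        where open ≡-Reasoning

  Palindrome : ℕ → ℕ → Set
  Palindrome n q = ∀ a b → a + suc b ≡ n → SameLetter (q + a) (q + b)

  module UniqueRightSpecial {n Q : ℕ} (Cn : factorComplexityIs z n (suc n)) (palindrome : Palindrome n Q)
    (deterministic-elsewhere : ∀ p → ¬ Agree n p Q → RightDeterministic n p) where

    no-return⇒periodic : ∀ {g} → Agree n (suc g) Q → (∀ c → c < suc n → ¬ Agree n (suc g + suc c) Q) →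
                         EventuallyPeriodic
    no-return⇒periodic {g} wg none with fewFactors-collision (Classes.few Cn) (λ t → suc g + toℕ t)
    ... | i , j , i<j , w = from-repeat (toℕ i) (toℕ j) i<j (toℕ<n j) w
      where
        from-repeat : ∀ a b → a < b → b < suc (suc n) → Agree n (suc g + a) (suc g + b) → EventuallyPeriodic
        from-repeat zero (suc b) _ b<n w =
          ⊥-elim (none b (s≤s⁻¹ b<n) (agree-trans (agree-sym w) (subst (λ t → Agree n t Q) (sym (+-identityʳ (suc g))) wg)))
        from-repeat (suc a) b a<b b<n w = deterministic-run⇒periodic {P = P} repeat run
          where
            P = proj₁ (m≤n⇒∃[o]m+o≡n a<b)
            a+P≡b : suc (suc a) + P ≡ b
            a+P≡b = proj₂ (m≤n⇒∃[o]m+o≡n a<b)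
            s = suc g + suc a

            repeat : Agree n s (s + suc P)
            repeat = subst (Agree n s)
              (trans (cong (suc g +_) (sym a+P≡b)) (solve 3 (λ g a P → g :+ (con 2 :+ a :+ P) := g :+ (con 1 :+ a) :+ (con 1 :+ P)) refl (suc g) a P)) w

            run : ∀ r → r < suc P → RightDeterministic n (s + r)
            run r r≤P = deterministic-elsewhere (s + r)
              (λ wq → none (a + r) a+r<1+n (subst (λ t → Agree n t Q) (+-assoc (suc g) (suc a) r) wq))
              where
                a+r<1+n : a + r < suc n
                a+r<1+n = m<n⇒m<1+n (≤-trans (s≤s (+-monoʳ-≤ a (s≤s⁻¹ r≤P))) (s≤s⁻¹ (subst (_≤ suc n) (sym a+P≡b) (s≤s⁻¹ b<n))))

    first-return⇒periodic : ∀ {g c} → SameLetter g (g + suc n) → Agree n (suc g) Q → RightDeterministic (suc n) g →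
      c < suc n → Agree n (suc g + suc c) Q → (∀ c′ → c′ < c → ¬ Agree n (suc g + suc c′) Q) → EventuallyPeriodic
    first-return⇒periodic {g} {c} g≈end wg det-g c≤n occ minimal =
      deterministic-run⇒periodic (agree-cons returns-letter (agree-trans wg (agree-sym occ))) run
      where
        -- an overlapping return of w is reflected by the palindrome, so it is again preceded by z g
        returns-letter : SameLetter g (g + suc c)
        returns-letter with c <? n
        ... | no c≮n = subst (λ t → SameLetter g (g + suc t)) (sym (≤-antisym (s≤s⁻¹ c≤n) (≮⇒≥ c≮n))) g≈end
        ... | yes c<n = begin
            z g                     ≡⟨ g≈end ⟩
            z (g + suc n)           ≡⟨ cong (λ t → z (g + suc t)) (sym c+e≡n) ⟩
            z (g + suc (suc c + e)) ≡⟨ cong z (solve 3 (λ g c e → g :+ (con 1 :+ (con 1 :+ c :+ e)) := con 1 :+ g :+ (con 1 :+ c) :+ e) refl g c e) ⟩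
            z (suc g + suc c + e)   ≡⟨ occ e e<n ⟩
            z (Q + e)               ≡⟨ sym (palindrome c e (trans (+-suc c e) c+e≡n)) ⟩
            z (Q + c)               ≡⟨ sym (wg c c<n) ⟩
            z (suc g + c)           ≡⟨ cong z (sym (+-suc g c)) ⟩
            z (g + suc c)           ∎
          where
            open ≡-Reasoning
            e = proj₁ (m≤n⇒∃[o]m+o≡n c<n)
            c+e≡n : suc c + e ≡ n
            c+e≡n = proj₂ (m≤n⇒∃[o]m+o≡n c<n)
            e<n : e < n
            e<n = subst (suc e ≤_) c+e≡n (s≤s (m≤n+m e c))

        run : ∀ r → r < suc c → RightDeterministic (suc n) (g + r)
        run zero _ = subst (RightDeterministic (suc n)) (sym (+-identityʳ g)) det-g
        run (suc r) r<c = deterministic-tail (deterministic-elsewhere (suc (g + suc r)) (minimal r (s≤s⁻¹ r<c)))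

    -- From g the word is forced letter by letter until w returns, and then it repeats.
    return⇒periodic : ∀ {g} → SameLetter g (g + suc n) → Agree n (suc g) Q → RightDeterministic (suc n) g →
                      EventuallyPeriodic
    return⇒periodic {g} g≈end wg det-g with least-below (λ c → agree? n (suc g + suc c) Q) (suc n)
    ... | inj₁ none = no-return⇒periodic wg none
    ... | inj₂ (c , c≤n , occ , minimal) = first-return⇒periodic g≈end wg det-g c≤n occ minimal

binom-cons-≡ : ∀ {m} {c b : Fin m} u w → c ≡ b → binom (c ∷ u) (b ∷ w) ≡ binom u (b ∷ w) + binom u w
binom-cons-≡ {c = c} {b} u w c≡b with c ≟F b
... | yes _ = refl
... | no c≢b = ⊥-elim (c≢b c≡b)

binom-cons-≢ : ∀ {m} {c b : Fin m} u w → c ≢ b → binom (c ∷ u) (b ∷ w) ≡ binom u (b ∷ w)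
binom-cons-≢ {c = c} {b} u w c≢b with c ≟F b
... | yes c≡b = ⊥-elim (c≢b c≡b)
... | no _ = refl

∼-singleton : ∀ {m k} {c d : Fin m} → 1 ≤ k → (c ∷ []) ∼[ k ] (d ∷ []) → c ≡ d
∼-singleton {c = c} {d} 1≤k c∼d with c ≟F d
... | yes c≡d = c≡d
... | no c≢d = ⊥-elim (0≢1+n (begin
    0                       ≡⟨ sym (binom-cons-≢ [] [] (λ d≡c → c≢d (sym d≡c))) ⟩
    binom (d ∷ []) (c ∷ []) ≡⟨ sym (c∼d (c ∷ []) 1≤k) ⟩
    binom (c ∷ []) (c ∷ []) ≡⟨ binom-cons-≡ {c = c} [] [] refl ⟩
    1                       ∎))
  where open ≡-Reasoning

sum< : (ℕ → ℕ) → ℕ → ℕ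
sum< f zero = 0
sum< f (suc n) = sum< f n + f n

sum<-≤-suc : ∀ (f g : ℕ → ℕ) n → f 0 ≡ 0 → (∀ t → t < suc n → f t ≤ suc (g t)) → sum< f (suc n) ≤ sum< g (suc n) + n
sum<-≤-suc f g zero f0≡0 _ rewrite f0≡0 = z≤n
sum<-≤-suc f g (suc n) f0≡0 f≤g = begin
    sum< f (suc n) + f (suc n)             ≤⟨ +-mono-≤ (sum<-≤-suc f g n f0≡0 (λ t t<n → f≤g t (m<n⇒m<1+n t<n))) (f≤g (suc n) ≤-refl) ⟩
    (sum< g (suc n) + n) + suc (g (suc n)) ≡⟨ solve 3 (λ a b c → (a :+ b) :+ (con 1 :+ c) := (a :+ c) :+ (con 1 :+ b))
                                                     refl (sum< g (suc n)) n (g (suc n)) ⟩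
    (sum< g (suc n) + g (suc n)) + suc n   ∎
  where open ≤-Reasoning

module Binary {m : ℕ} (z : Word m) {α β : Fin m} (α≢β : α ≢ β) (binary : ∀ p → z p ≡ α ⊎ z p ≡ β) where
  open Factors z

  isα : Fin m → ℕ
  isα c with c ≟F α
  ... | yes _ = 1
  ... | no _ = 0

  isα-α : ∀ {c} → c ≡ α → isα c ≡ 1
  isα-α {c} c≡α with c ≟F α
  ... | yes _ = refl
  ... | no c≢α = ⊥-elim (c≢α c≡α)

  isα-β : ∀ {c} → c ≡ β → isα c ≡ 0
  isα-β {c} c≡β with c ≟F α
  ... | yes c≡α = ⊥-elim (α≢β (trans (sym c≡α) c≡β))
  ... | no _ = refl

  isα≤1 : ∀ c → isα c ≤ 1
  isα≤1 c with c ≟F α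
  ... | yes _ = s≤s z≤n
  ... | no _ = z≤n

  isα-positive : ∀ p → 1 ≤ isα (z p) → z p ≡ α
  isα-positive p 1≤isα with binary p
  ... | inj₁ zp≡α = zp≡α
  ... | inj₂ zp≡β = ⊥-elim (1+n≰n (subst (1 ≤_) (isα-β zp≡β) 1≤isα))

  isα-zero : ∀ p → isα (z p) ≤ 0 → z p ≡ β
  isα-zero p isα≤0 with binary p
  ... | inj₁ zp≡α = ⊥-elim (1+n≰n (subst (_≤ 0) (isα-α zp≡α) isα≤0))
  ... | inj₂ zp≡β = zp≡β

  count : ℕ → ℕ → ℕ
  count p zero = 0
  count p (suc n) = isα (z p) + count (suc p) n

  weight : ℕ → ℕ → ℕ
  weight p zero = 0
  weight p (suc n) = isα (z p) * n + weight (suc p) n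

  Balanced : ℕ → Set
  Balanced l = ∀ p q → count q l ≤ suc (count p l)

  ≢α : ∀ {c} → c ≡ β → c ≢ α
  ≢α c≡β c≡α = α≢β (trans (sym c≡α) c≡β)

  ≢β : ∀ {c} → c ≡ α → c ≢ β
  ≢β c≡α c≡β = α≢β (trans (sym c≡α) c≡β)

  binom-α≡count : ∀ p n → binom (letters p n) (α ∷ []) ≡ count p n
  binom-α≡count p zero = refl
  binom-α≡count p (suc n) with binary p
  ... | inj₁ zp≡α = begin
      binom (z p ∷ letters (suc p) n) (α ∷ []) ≡⟨ binom-cons-≡ (letters (suc p) n) [] zp≡α ⟩
      binom (letters (suc p) n) (α ∷ []) + 1   ≡⟨ +-comm _ 1 ⟩
      1 + binom (letters (suc p) n) (α ∷ [])   ≡⟨ cong₂ _+_ (sym (isα-α zp≡α)) (binom-α≡count (suc p) n) ⟩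
      isα (z p) + count (suc p) n              ∎
    where open ≡-Reasoning
  ... | inj₂ zp≡β = begin
      binom (z p ∷ letters (suc p) n) (α ∷ []) ≡⟨ binom-cons-≢ (letters (suc p) n) [] (≢α zp≡β) ⟩
      binom (letters (suc p) n) (α ∷ [])       ≡⟨ cong₂ _+_ (sym (isα-β zp≡β)) (binom-α≡count (suc p) n) ⟩
      isα (z p) + count (suc p) n              ∎
    where open ≡-Reasoning

  binom-β+count≡length : ∀ p n → binom (letters p n) (β ∷ []) + count p n ≡ n
  binom-β+count≡length p zero = refl
  binom-β+count≡length p (suc n) with binary p
  ... | inj₁ zp≡α rewrite binom-cons-≢ (letters (suc p) n) [] (≢β zp≡α) | isα-α zp≡α =
    trans (+-suc _ _) (cong suc (binom-β+count≡length (suc p) n))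
  ... | inj₂ zp≡β rewrite binom-cons-≡ (letters (suc p) n) [] zp≡β | isα-β zp≡β =
    trans (cong (_+ count (suc p) n) (+-comm _ 1)) (cong suc (binom-β+count≡length (suc p) n))

  binom-αα+αβ≡weight : ∀ p n → binom (letters p n) (α ∷ α ∷ []) + binom (letters p n) (α ∷ β ∷ []) ≡ weight p n
  binom-αα+αβ≡weight p zero = refl
  binom-αα+αβ≡weight p (suc n) with binary p
  ... | inj₁ zp≡α rewrite binom-cons-≡ (letters (suc p) n) (α ∷ []) zp≡α
                        | binom-cons-≡ (letters (suc p) n) (β ∷ []) zp≡α | isα-α zp≡α = begin
      (#αα + #α) + (#αβ + #β)  ≡⟨ solve 4 (λ a b c d → (a :+ b) :+ (c :+ d) := (d :+ b) :+ (a :+ c)) refl #αα #α #αβ #β ⟩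
      (#β + #α) + (#αα + #αβ)  ≡⟨ cong₂ _+_ (trans (cong (#β +_) (binom-α≡count (suc p) n)) (binom-β+count≡length (suc p) n))
                                         (binom-αα+αβ≡weight (suc p) n) ⟩
      n + weight (suc p) n     ≡⟨ cong (_+ weight (suc p) n) (sym (*-identityˡ n)) ⟩
      1 * n + weight (suc p) n ∎
    where
      open ≡-Reasoning
      #αα = binom (letters (suc p) n) (α ∷ α ∷ [])
      #α = binom (letters (suc p) n) (α ∷ [])
      #αβ = binom (letters (suc p) n) (α ∷ β ∷ [])
      #β = binom (letters (suc p) n) (β ∷ [])
  ... | inj₂ zp≡β rewrite binom-cons-≢ (letters (suc p) n) (α ∷ []) (≢α zp≡β)
                        | binom-cons-≢ (letters (suc p) n) (β ∷ []) (≢α zp≡β) | isα-β zp≡β =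
    binom-αα+αβ≡weight (suc p) n

  sum<-count-shift : ∀ p n → sum< (count p) (suc n) ≡ isα (z p) * n + sum< (count (suc p)) n
  sum<-count-shift p zero = sym (cong (_+ 0) (*-zeroʳ (isα (z p))))
  sum<-count-shift p (suc n) rewrite sum<-count-shift p n | *-suc (isα (z p)) n =
    solve 4 (λ a b c d → (b :+ c) :+ (a :+ d) := (a :+ b) :+ (c :+ d)) refl
      (isα (z p)) (isα (z p) * n) (sum< (count (suc p)) n) (count (suc p) n)

  weight≡sum<-count : ∀ p n → weight p n ≡ sum< (count p) n
  weight≡sum<-count p zero = refl
  weight≡sum<-count p (suc n) = trans (cong (isα (z p) * n +_) (weight≡sum<-count (suc p) n)) (sym (sum<-count-shift p n))

  -- An α-start outweighs a β-start by n, which the balanced shorter prefixes cannot make up.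
  ¬α-β-same-count-weight : ∀ n {i j} → z i ≡ α → z j ≡ β → (∀ l → l < suc n → Balanced l) →
    count i (suc n) ≡ count j (suc n) → weight i (suc n) ≡ weight j (suc n) → ⊥
  ¬α-β-same-count-weight zero zi≡α zj≡β _ count≡ _ rewrite isα-α zi≡α | isα-β zj≡β = 1+n≢0 count≡
  ¬α-β-same-count-weight (suc n) {i} {j} zi≡α zj≡β bal _ weight≡ rewrite isα-α zi≡α | isα-β zj≡β =
    1+n≰n (subst (_≤ wi + n) (cong suc (+-comm n wi)) (begin
      suc n + wi                      ≡⟨ cong (_+ wi) (sym (*-identityˡ (suc n))) ⟩
      1 * suc n + wi                  ≡⟨ weight≡ ⟩
      weight (suc j) (suc n)          ≡⟨ weight≡sum<-count (suc j) (suc n) ⟩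
      sum< (count (suc j)) (suc n)    ≤⟨ sum<-≤-suc (count (suc j)) (count (suc i)) n refl
                                           (λ t t<n → bal t (m<n⇒m<1+n t<n) (suc i) (suc j)) ⟩
      sum< (count (suc i)) (suc n) + n ≡⟨ cong (_+ n) (sym (weight≡sum<-count (suc i) (suc n))) ⟩
      wi + n                          ∎))
    where
      open ≤-Reasoning
      wi = weight (suc i) (suc n)

  same-start : ∀ n {i j} → (∀ l → l < suc n → Balanced l) →
    count i (suc n) ≡ count j (suc n) → weight i (suc n) ≡ weight j (suc n) → SameLetter i j
  same-start n {i} {j} bal count≡ weight≡ with binary i | binary j
  ... | inj₁ zi≡α | inj₁ zj≡α = trans zi≡α (sym zj≡α)
  ... | inj₂ zi≡β | inj₂ zj≡β = trans zi≡β (sym zj≡β)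
  ... | inj₁ zi≡α | inj₂ zj≡β = ⊥-elim (¬α-β-same-count-weight n zi≡α zj≡β bal count≡ weight≡)
  ... | inj₂ zi≡β | inj₁ zj≡α = ⊥-elim (¬α-β-same-count-weight n zj≡α zi≡β bal (sym count≡) (sym weight≡))

  agree-of-count-weight : ∀ n → (∀ l → l < n → Balanced l) →
    ∀ {i j} → count i n ≡ count j n → weight i n ≡ weight j n → Agree n i j
  agree-of-count-weight zero _ _ _ _ ()
  agree-of-count-weight (suc n) bal {i} {j} count≡ weight≡ =
    agree-cons i≈j (agree-of-count-weight n (λ l l<n → bal l (m<n⇒m<1+n l<n)) count≡′ weight≡′)
    where
      i≈j = same-start n bal count≡ weight≡
      isα≡ : isα (z i) ≡ isα (z j)
      isα≡ = cong isα i≈j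
      count≡′ : count (suc i) n ≡ count (suc j) n
      count≡′ = +-cancelˡ-≡ (isα (z i)) _ _ (trans count≡ (cong (_+ count (suc j) n) (sym isα≡)))
      weight≡′ : weight (suc i) n ≡ weight (suc j) n
      weight≡′ = +-cancelˡ-≡ (isα (z i) * n) _ _ (trans weight≡ (cong (λ t → t * n + weight (suc j) n) (sym isα≡)))

  ∼⇒agree : ∀ {k} → 2 ≤ k → ∀ n → (∀ l → l < n → Balanced l) →
    ∀ p q → toList (factor z p n) ∼[ k ] toList (factor z q n) → Agree n p q
  ∼⇒agree {k} 2≤k n bal p q p∼q = agree-of-count-weight n bal count≡ weight≡
    where
      same-binom : ∀ x → length x ≤ k → binom (letters p n) x ≡ binom (letters q n) x
      same-binom x |x|≤k = subst₂ (λ u v → binom u x ≡ binom v x) (toList-factor p n) (toList-factor q n) (p∼q x |x|≤k)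
      count≡ : count p n ≡ count q n
      count≡ = trans (sym (binom-α≡count p n)) (trans (same-binom (α ∷ []) (≤-trans (s≤s z≤n) 2≤k)) (binom-α≡count q n))
      weight≡ : weight p n ≡ weight q n
      weight≡ = trans (sym (binom-αα+αβ≡weight p n))
        (trans (cong₂ _+_ (same-binom (α ∷ α ∷ []) 2≤k) (same-binom (α ∷ β ∷ []) 2≤k)) (binom-αα+αβ≡weight q n))

  count-agree : ∀ n {p q} → Agree n p q → count p n ≡ count q n
  count-agree zero _ = refl
  count-agree (suc n) w = cong₂ _+_ (cong isα (agree-head w)) (count-agree n (agree-tail w))

  count-split : ∀ p a b → count p (a + b) ≡ count p a + count (p + a) b
  count-split p zero b = cong (λ t → count t b) (sym (+-identityʳ p))
  count-split p (suc a) b rewrite count-split (suc p) a b | +-suc p a = sym (+-assoc (isα (z p)) (count (suc p) a) _)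

  count-snoc : ∀ p n → count p (suc n) ≡ count p n + isα (z (p + n))
  count-snoc p n = trans (cong (count p) (+-comm 1 n)) (trans (count-split p n 1) (cong (count p n +_) (+-identityʳ _)))

  count-reverse : ∀ s a b → (∀ r r′ → r + suc r′ ≡ s → SameLetter (a + r) (b + r′)) → count a s ≡ count b s
  count-reverse zero a b _ = refl
  count-reverse (suc s) a b mirrored =
    trans (cong₂ _+_ first (count-reverse s (suc a) b mirrored′)) (trans (+-comm (isα (z (b + s))) (count b s)) (sym (count-snoc b s)))
    where
      first : isα (z a) ≡ isα (z (b + s))
      first = cong isα (trans (cong z (sym (+-identityʳ a))) (mirrored 0 s refl))
      mirrored′ : ∀ r r′ → r + suc r′ ≡ s → SameLetter (suc a + r) (b + r′)
      mirrored′ r r′ e = trans (cong z (sym (+-suc a r))) (mirrored (suc r) r′ (cong suc e))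

  count≤ : ∀ p n → count p n ≤ n
  count≤ p zero = z≤n
  count≤ p (suc n) = +-mono-≤ (isα≤1 (z p)) (count≤ (suc p) n)

  letters-of-isα-gap : ∀ {u v} → suc (isα (z u)) ≤ isα (z v) → z v ≡ α × z u ≡ β
  letters-of-isα-gap {u} {v} gap = isα-positive v (≤-trans (s≤s z≤n) gap) , isα-zero u (s≤s⁻¹ (≤-trans gap (isα≤1 (z v))))

  -- A surplus of two in count forces α against β at both ends, since the inner parts differ by at most one.
  unbalanced-ends : ∀ n {u v} → Balanced n → suc (suc (count u (suc n))) ≤ count v (suc n) →
                    (z v ≡ α × z u ≡ β) × (z (v + n) ≡ α × z (u + n) ≡ β)
  unbalanced-ends n {u} {v} bal surplus = letters-of-isα-gap (gap (bal (suc u) (suc v)) surplus) ,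
    letters-of-isα-gap (gap (bal u v) (subst₂ (λ a b → suc (suc a) ≤ b) (snoc u) (snoc v) surplus))
    where
      gap : ∀ {iu iv c cv} → cv ≤ suc c → suc (suc (iu + c)) ≤ iv + cv → suc iu ≤ iv
      gap {iu} {iv} {c} {cv} cv≤1+c h = +-cancelʳ-≤ (suc c) (suc iu) iv (begin
          suc iu + suc c     ≡⟨ cong suc (+-suc iu c) ⟩
          suc (suc (iu + c)) ≤⟨ h ⟩
          iv + cv            ≤⟨ +-monoʳ-≤ iv cv≤1+c ⟩
          iv + suc c         ∎)
        where open ≤-Reasoning
      snoc : ∀ p → count p (suc n) ≡ isα (z (p + n)) + count p n
      snoc p = trans (count-snoc p n) (+-comm (count p n) _)

  balanced-forbids-αuα-βvβ : ∀ s {p q} → Balanced (suc (suc s)) → z p ≡ α → z (suc p + s) ≡ α →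
    z q ≡ β → z (suc q + s) ≡ β → count (suc p) s ≢ count (suc q) s
  balanced-forbids-αuα-βvβ s {p} {q} bal zp≡α zp′≡α zq≡β zq′≡β count≡ =
    1+n≰n (subst₂ _≤_ count-p (cong suc count-q) (bal q p))
    where
      around : ∀ r → count r (suc (suc s)) ≡ isα (z r) + (count (suc r) s + isα (z (suc r + s)))
      around r = cong (isα (z r) +_) (count-snoc (suc r) s)
      count-p : count p (suc (suc s)) ≡ suc (suc (count (suc p) s))
      count-p = trans (around p) (trans (cong₂ (λ a b → a + (count (suc p) s + b)) (isα-α zp≡α) (isα-α zp′≡α))
                                        (cong suc (+-comm _ 1)))
      count-q : count q (suc (suc s)) ≡ count (suc p) s
      count-q = trans (around q) (trans (cong₂ (λ a b → a + (count (suc q) s + b)) (isα-β zq≡β) (isα-β zq′≡β))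
                                        (trans (+-identityʳ _) (sym count≡)))

  module UnbalancedPair {n x y : ℕ} (many : ∀ l → ManyFactors l (suc l))
    (sturmian : ∀ l → l ≤ suc (suc n) → factorComplexityIs z l (suc l))
    (bal : ∀ l → l < suc (suc n) → Balanced l)
    (surplus : suc (suc (count x (suc (suc n)))) ≤ count y (suc (suc n))) where

    Cn : factorComplexityIs z n (suc n)
    Cn = sturmian n (≤-trans (n≤1+n n) (n≤1+n (suc n)))

    Cn+1 : factorComplexityIs z (suc n) (suc (suc n))
    Cn+1 = sturmian (suc n) (n≤1+n (suc n))

    ends = unbalanced-ends (suc n) (bal (suc n) ≤-refl) surplus

    zy≡α : z y ≡ α
    zy≡α = proj₁ (proj₁ ends)

    zx≡β : z x ≡ β
    zx≡β = proj₂ (proj₁ ends)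

    zy′≡α : z (y + suc n) ≡ α
    zy′≡α = proj₁ (proj₂ ends)

    zx′≡β : z (x + suc n) ≡ β
    zx′≡β = proj₂ (proj₂ ends)

    split-at : ∀ p s e → suc s + e ≡ n → count p (suc n) ≡ count p s + (isα (z (p + s)) + count (suc (p + s)) (suc e))
    split-at p s e s+e≡n = trans (cong (count p) (trans (cong suc (sym s+e≡n)) (sym (trans (+-suc s (suc e)) (cong suc (+-suc s e))))))
                                 (count-split p s (suc (suc e)))

    -- At a first difference β/α the suffixes would need a surplus of two, against balance.
    extend-middles : ∀ s → suc s ≤ n → Agree s (suc y) (suc x) → Agree (suc s) (suc y) (suc x)
    extend-middles s s<n prefix with z (suc y + s) ≟F z (suc x + s)
    ... | yes same = agree-snoc prefix same
    ... | no differ with binary (suc y + s) | binary (suc x + s)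
    ...   | inj₁ a | inj₁ b = ⊥-elim (differ (trans a (sym b)))
    ...   | inj₂ a | inj₂ b = ⊥-elim (differ (trans a (sym b)))
    ...   | inj₁ a | inj₂ b = ⊥-elim (balanced-forbids-αuα-βvβ s (bal (suc (suc s)) (s≤s (s≤s s<n))) zy≡α a zx≡β b (count-agree s prefix))
    ...   | inj₂ a | inj₁ b = ⊥-elim (1+n≰n (≤-trans (s≤s⁻¹ surplus′) (+-monoʳ-≤ c rest-balanced)))
      where
        e = proj₁ (m≤n⇒∃[o]m+o≡n s<n)
        s+e≡n : suc s + e ≡ n
        s+e≡n = proj₂ (m≤n⇒∃[o]m+o≡n s<n)
        c = count (suc y) s
        rest-x = count (suc (suc x + s)) (suc e)
        rest-y = count (suc (suc y + s)) (suc e)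
        count-y : count y (suc (suc n)) ≡ suc (c + rest-y)
        count-y = trans (cong₂ _+_ (isα-α zy≡α) (split-at (suc y) s e s+e≡n)) (cong (λ t → suc (c + (t + rest-y))) (isα-β a))
        count-x : count x (suc (suc n)) ≡ c + suc rest-x
        count-x = trans (cong₂ _+_ (isα-β zx≡β) (split-at (suc x) s e s+e≡n))
                        (cong₂ (λ t u → t + (u + rest-x)) (sym (count-agree s prefix)) (isα-α b))
        surplus′ : suc (suc (c + suc rest-x)) ≤ suc (c + rest-y)
        surplus′ = subst₂ (λ a b → suc (suc a) ≤ b) count-x count-y surplus
        rest-balanced : rest-y ≤ suc rest-x
        rest-balanced = bal (suc e) (s≤s (≤-trans (subst (suc e ≤_) s+e≡n (s≤s (m≤n+m e s))) (n≤1+n n))) (suc (suc x + s)) (suc (suc y + s))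

    agree-middles : ∀ s → s ≤ n → Agree s (suc y) (suc x)
    agree-middles zero _ _ ()
    agree-middles (suc s) s<n = extend-middles s s<n (agree-middles s (<⇒≤ s<n))

    middles : Agree n (suc y) (suc x)
    middles = agree-middles n ≤-refl

    PalindromeBelow : ℕ → Set
    PalindromeBelow s = ∀ a b → a < s → a + suc b ≡ n → SameLetter (suc y + a) (suc y + b)

    count-mirror : ∀ s → PalindromeBelow s → ∀ b → s + suc b ≡ n → count (suc y) s ≡ count (suc (suc y + b)) s
    count-mirror s pal b s+b≡n = count-reverse s (suc y) (suc (suc y + b)) λ r r′ r+r′≡s →
      trans (pal r (b + suc r′) (subst (suc r ≤_) (trans (sym (+-suc r r′)) r+r′≡s) (s≤s (m≤m+n r r′)))
                 (trans (solve 3 (λ r b r′ → r :+ (con 1 :+ (b :+ (con 1 :+ r′))) := (r :+ (con 1 :+ r′)) :+ (con 1 :+ b)) refl r b r′)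
                        (trans (cong (_+ suc b) r+r′≡s) s+b≡n)))
            (cong z (solve 3 (λ y b r′ → con 1 :+ y :+ (b :+ (con 1 :+ r′)) := con 1 :+ (con 1 :+ y :+ b) :+ r′) refl y b r′))

    wrap : ∀ p s b → s + suc b ≡ n → suc (suc p + b) + s ≡ p + suc n
    wrap p s b s+b≡n = trans (solve 3 (λ p b s → con 1 :+ (con 1 :+ p :+ b) :+ s := p :+ (con 1 :+ (s :+ (con 1 :+ b)))) refl p b s)
                             (cong (λ t → p + suc t) s+b≡n)

    -- A mismatch at the first asymmetric pair would produce αuα against βvβ with count u = count v.
    extend-palindrome : ∀ s → suc s ≤ n → PalindromeBelow s → ∀ b → s + suc b ≡ n → SameLetter (suc y + s) (suc y + b)
    extend-palindrome s s<n pal b s+b≡n with z (suc y + s) ≟F z (suc y + b)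
    ... | yes same = same
    ... | no differ with binary (suc y + s) | binary (suc y + b)
    ...   | inj₁ a | inj₁ c = ⊥-elim (differ (trans a (sym c)))
    ...   | inj₂ a | inj₂ c = ⊥-elim (differ (trans a (sym c)))
    ...   | inj₁ a | inj₂ c = ⊥-elim (balanced-forbids-αuα-βvβ s (bal (suc (suc s)) (s≤s (s≤s s<n))) zy≡α a
        (trans (sym (middles b b<n)) c) (trans (cong z (wrap x s b s+b≡n)) zx′≡β)
        (trans (count-mirror s pal b s+b≡n) (sym shifted)))
      where
        b<n : b < n
        b<n = subst (suc b ≤_) s+b≡n (m≤n+m (suc b) s)
        shifted : count (suc (suc x + b)) s ≡ count (suc (suc y + b)) s
        shifted = count-agree s (subst₂ (Agree s) (+-suc (suc x) b) (+-suc (suc y) b)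
          (agree-slice (suc b) (≤-reflexive (trans (+-comm (suc b) s) s+b≡n)) (agree-sym middles)))
    ...   | inj₂ a | inj₁ c = ⊥-elim (balanced-forbids-αuα-βvβ s (bal (suc (suc s)) (s≤s (s≤s s<n))) c
        (trans (cong z (wrap y s b s+b≡n)) zy′≡α) zx≡β (trans (sym (middles s s<n)) a)
        (trans (sym (count-mirror s pal b s+b≡n)) (count-agree s (agree-≤ (<⇒≤ s<n) middles))))

    palindrome-below : ∀ s → s ≤ n → PalindromeBelow s
    palindrome-below zero _ _ _ ()
    palindrome-below (suc s) s<n a b a<1+s a+b≡n with a <? s
    ... | yes a<s = palindrome-below s (<⇒≤ s<n) a b a<s a+b≡n
    ... | no a≮s rewrite ≤-antisym (s≤s⁻¹ a<1+s) (≮⇒≥ a≮s) = extend-palindrome s s<n (palindrome-below s (<⇒≤ s<n)) b a+b≡n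

    middle-palindrome : Palindrome n (suc y)
    middle-palindrome a b a+b≡n = palindrome-below n ≤-refl a b (subst (a <_) a+b≡n (m<m+n a (s≤s z≤n))) a+b≡n

    middle-special : RightSpecial n (suc y) (suc x)
    middle-special = middles , λ e → α≢β (trans (sym (end y zy′≡α)) (trans e (end x zx′≡β)))
      where
        end : ∀ {c} p → z (p + suc n) ≡ c → z (suc p + n) ≡ c
        end p e = trans (cong z (sym (+-suc p n))) e

    deterministic-elsewhere : ∀ p → ¬ Agree n p (suc y) → RightDeterministic n p
    deterministic-elsewhere p ¬w p′ w′ with z (p′ + n) ≟F z (p + n)
    ... | yes same = same
    ... | no differ = ⊥-elim (¬w (rightSpecial-unique Cn Cn+1 (agree-sym w′ , λ e → differ (sym e)) middle-special))

    open UniqueRightSpecial Cn middle-palindrome deterministic-elsewhere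

    ¬deterministic : ∀ {g} → SameLetter g (g + suc n) → Agree n (suc g) (suc y) → ¬ RightDeterministic (suc n) g
    ¬deterministic g≈end wg det = aperiodic many (return⇒periodic g≈end wg det)

    -- αw and βw are then two distinct right special factors of length n + 1.
    contradiction : ⊥
    contradiction =
      ¬deterministic⇒¬¬rightSpecial (¬deterministic (trans zy≡α (sym zy′≡α)) agree-refl) λ (_ , special-y) →
      ¬deterministic⇒¬¬rightSpecial (¬deterministic (trans zx≡β (sym zx′≡β)) (agree-sym middles)) λ (_ , special-x) →
      α≢β (trans (sym zy≡α) (trans (agree-head (rightSpecial-unique Cn+1 (sturmian (suc (suc n)) ≤-refl) special-y special-x)) zx≡β))

  balanced-step : ∀ n → (∀ l → ManyFactors l (suc l)) → (∀ l → l ≤ n → factorComplexityIs z l (suc l)) →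
                  (∀ l → l < n → Balanced l) → Balanced n
  balanced-step zero _ _ _ p q = z≤n
  balanced-step (suc zero) _ _ _ p q = ≤-trans (count≤ q 1) (s≤s z≤n)
  balanced-step (suc (suc n)) many sturmian bal p q with count q (suc (suc n)) ≤? suc (count p (suc (suc n)))
  ... | yes balanced = balanced
  ... | no unbalanced = ⊥-elim (UnbalancedPair.contradiction {n} {p} {q} many sturmian bal (≰⇒> unbalanced))

∼-reflexive : ∀ {m k n} {u v : Vec (Fin m) n} → u ≡ v → toList u ∼[ k ] toList v
∼-reflexive refl _ _ = refl

module BinomialComplexity {m : ℕ} (z : Word m) {k : ℕ} (2≤k : 2 ≤ k) (H : ∀ n → binomialComplexityIs k z n (suc n)) where
  open Factors z

  many : ∀ n → ManyFactors n (suc n)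
  many n = classCount⇒manyFactors ∼-reflexive (H n)

  α β : Fin m
  α = z (proj₁ (H 1) fz)
  β = z (proj₁ (H 1) (fs fz))

  α≢β : α ≢ β
  α≢β α≡β with proj₂ (many 1) fz (fs fz) (agree-cons α≡β (λ _ ()))
  ... | ()

  letter-of-∼ : ∀ {p q} → (z (p + 0) ∷ []) ∼[ k ] (z (q + 0) ∷ []) → z p ≡ z q
  letter-of-∼ {p} {q} p∼q = subst₂ _≡_ (cong z (+-identityʳ p)) (cong z (+-identityʳ q)) (∼-singleton (≤-trans (s≤s z≤n) 2≤k) p∼q)

  binary : ∀ p → z p ≡ α ⊎ z p ≡ β
  binary p with proj₂ (proj₂ (H 1)) p
  ... | fz , p∼rep = inj₁ (letter-of-∼ p∼rep)
  ... | fs fz , p∼rep = inj₂ (letter-of-∼ p∼rep)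

  open Binary z α≢β binary

  sturmian-below-balanced : ∀ n → (∀ l → l < n → Balanced l) → factorComplexityIs z n (suc n)
  sturmian-below-balanced n bal = classCount-≡ ∼-reflexive (λ p q p∼q → agree⇒factor≡ (∼⇒agree 2≤k n bal p q p∼q)) (H n)

  all-balanced : ∀ n → Balanced n
  all-balanced = <-rec Balanced λ n below →
    balanced-step n many (λ l l≤n → sturmian-below-balanced l (λ l′ l′<l → below (<-≤-trans l′<l l≤n))) (λ l → below)

theorem2p11 : (m : ℕ) (z : Word m) (k : ℕ) → 2 ≤ k →
    (∀ n → binomialComplexityIs k z n (suc n)) → Sturmian z
theorem2p11 m z k 2≤k H n = sturmian-below-balanced n (λ l _ → all-balanced l)
  where open BinomialComplexity z 2≤k H
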